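{- There is a linear functor $\Phi: I(\mathbb{N},\mid)\to I(\mathbb{N}^\times)$ such that $\Phi\circ\iota$ is (naturally equivalent to) the identity of $I(\mathbb{N}^\times)$, where $\iota:I(\mathbb{N}^\times)\to I(\mathbb{N},\mid)$ is the embedding identifying $I(\mathbb{N}^\times)$ with the reduced incidence subalgebra $\widetilde{I}(\mathbb{N},\mid)$.
   Context: $I(\mathbb{N}^\times)$ is the category of sets over $\mathbb{N}$ (sets $X$ with a map $f:X\to\mathbb{N}$); $I(\mathbb{N},\mid)$ is the category of sets over the set $S_1=\{[a,b]: a\mid b\}$ of intervals of the division poset. A linear functor from sets over $A$ to sets over $B$ is one of the form $(X\to A)\mapsto(X\times_A M\to B)$ for a span $A\leftarrow M\to B$. The embedding $\iota$ (induced by the decalage map $(\mathbb{N},\mid)\to\mathbb{N}^\times$, $[a,b]\mapsto b/a$) sends $f:X\to\mathbb{N}$ to $\{(x,[a,b])\in X\times S_1: b=a f(x)\}\to S_1$. -}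

module Defs where

open import Data.Nat using (ℕ; _*_; NonZero)
open import Data.Nat.Divisibility using (_∣_)
open import Data.Product using (Σ; Σ-syntax; _,_; proj₁; proj₂)
open import Function.Bundles using (_↔_; Inverse)
open import Relation.Binary.PropositionalEquality using (_≡_; refl; sym; trans; cong)

-- Positive natural numbers (the carrier of ℕ^× and of the division poset (ℕ,∣)).
ℕ⁺ : Set
ℕ⁺ = Σ[ n ∈ ℕ ] NonZero n

val : ℕ⁺ → ℕ
val = proj₁

S₁ : Set
S₁ = Σ[ a ∈ ℕ⁺ ] Σ[ b ∈ ℕ⁺ ] (val a ∣ val b)

lo hi : S₁ → ℕ⁺
lo i = proj₁ i
hi i = proj₁ (proj₂ i)

-- The category I(A) of sets over A.
record SetOver (A : Set) : Set₁ where
  constructor over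
  field
    Carrier : Set
    map     : Carrier → A
open SetOver public

record Hom {A : Set} (X Y : SetOver A) : Set where
  constructor hom
  field
    fun      : Carrier X → Carrier Y
    commutes : ∀ x → map Y (fun x) ≡ map X x
open Hom public

record Span (A B : Set) : Set₁ where
  constructor span
  field
    M   : Set
    src : M → A
    tgt : M → B
open Span public

Lin : {A B : Set} → Span A B → SetOver A → SetOver B
Lin sp X = over (Σ[ x ∈ Carrier X ] Σ[ m ∈ M sp ] (map X x ≡ src sp m))
                (λ z → tgt sp (proj₁ (proj₂ z)))

Lin-map : {A B : Set} (sp : Span A B) {X Y : SetOver A} →
          Hom X Y → Hom (Lin sp X) (Lin sp Y)
Lin-map sp h = hom (λ { (x , m , e) → fun h x , m , trans (commutes h x) e })
                   (λ _ → refl)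

ι : SetOver ℕ⁺ → SetOver S₁
ι X = over (Σ[ x ∈ Carrier X ] Σ[ i ∈ S₁ ] (val (hi i) ≡ val (lo i) * val (map X x)))
           (λ z → proj₁ (proj₂ z))

ι-map : {X Y : SetOver ℕ⁺} → Hom X Y → Hom (ι X) (ι Y)
ι-map {X} {Y} h =
  hom (λ { (x , i , e) → fun h x , i ,
             trans e (cong (λ n → val (lo i) * val n) (sym (commutes h x))) })
      (λ _ → refl)

record NatIsoToId {A : Set}
    (F₀ : SetOver A → SetOver A)
    (F₁ : {X Y : SetOver A} → Hom X Y → Hom (F₀ X) (F₀ Y)) : Set₁ where
  field
    iso       : (X : SetOver A) → Carrier (F₀ X) ↔ Carrier X
    over-base : (X : SetOver A) (z : Carrier (F₀ X)) →
                map X (Inverse.to (iso X) z) ≡ map (F₀ X) z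
    natural   : {X Y : SetOver A} (h : Hom X Y) (z : Carrier (F₀ X)) →
                Inverse.to (iso Y) (fun (F₁ h) z) ≡ fun h (Inverse.to (iso X) z)

{-# OPTIONS --safe #-}
module Submission where

open import Defs
open import Data.Product using (Σ-syntax; _,_; proj₁; proj₂)
open import Data.Nat using (suc; _*_)
open import Data.Nat.Properties using (*-identityˡ; ≡-irrelevant)
open import Data.Nat.Divisibility using (1∣_)
open import Function.Base using (_∘_)
open import Function.Bundles using (mk↔ₛ′)
open import Relation.Binary.PropositionalEquality using (_≡_; refl; sym; trans; cong)

-- Φ is the linear functor of the span S₁ ← ℕ⁺ → ℕ⁺ picking the initial intervals [1,n]:
-- among the intervals [a, a·f(x)] attached to x by ι exactly one is initial, namely [1, f(x)],
-- so Φ(ι X) has one point over each x, lying over f(x).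

val-injective : {m n : ℕ⁺} → val m ≡ val n → m ≡ n
val-injective {suc _ , _} {suc _ , _} refl = refl

initialInterval : ℕ⁺ → S₁
initialInterval n = (1 , _) , n , 1∣ val n

initialSpan : Span S₁ ℕ⁺
initialSpan = span ℕ⁺ initialInterval (λ n → n)

InitialIntervalOfLength : ℕ⁺ → Set
InitialIntervalOfLength m =
  Σ[ i ∈ S₁ ] Σ[ _ ∈ val (hi i) ≡ val (lo i) * val m ] Σ[ n ∈ ℕ⁺ ] (i ≡ initialInterval n)

initialIntervalOfLength : (m : ℕ⁺) → InitialIntervalOfLength m
initialIntervalOfLength m = initialInterval m , sym (*-identityˡ (val m)) , m , refl

initialIntervalOfLength-unique : (m : ℕ⁺) (j : InitialIntervalOfLength m) →
                                 initialIntervalOfLength m ≡ j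
initialIntervalOfLength-unique m (.(initialInterval n) , e , n , refl)
  with val-injective {n} {m} (trans e (*-identityˡ (val m)))
... | refl = cong (λ e′ → initialInterval m , e′ , m , refl) (≡-irrelevant _ _)

lemma4p11 : Σ[ sp ∈ Span S₁ ℕ⁺ ] NatIsoToId (λ X → Lin sp (ι X)) (λ h → Lin-map sp (ι-map h))
lemma4p11 = initialSpan , record
  { iso       = λ X → mk↔ₛ′ (forget X) (remember X) (λ _ → refl) (remember∘forget X)
  ; over-base = λ { X ((x , i , e) , n , p) →
                    cong (proj₁ ∘ proj₂ ∘ proj₂)
                         (initialIntervalOfLength-unique (map X x) (i , e , n , p)) }
  ; natural   = λ _ _ → refl
  }
  where
  forget : (X : SetOver ℕ⁺) → Carrier (Lin initialSpan (ι X)) → Carrier X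
  forget X ((x , _) , _) = x

  remember : (X : SetOver ℕ⁺) → Carrier X → Carrier (Lin initialSpan (ι X))
  remember X x with initialIntervalOfLength (map X x)
  ... | i , e , n , p = (x , i , e) , n , p

  remember∘forget : (X : SetOver ℕ⁺) (z : Carrier (Lin initialSpan (ι X))) →
                    remember X (forget X z) ≡ z
  remember∘forget X ((x , i , e) , n , p) =
    cong (λ { (i′ , e′ , n′ , p′) → (x , i′ , e′) , n′ , p′ })
         (initialIntervalOfLength-unique (map X x) (i , e , n , p))
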